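{- For each $m\ge1$, let $c_{2,m}$ be the number of move-equivalence classes of $(2,m)$-amplitrees. Then $$c_{2,m}=1^2+2^2+\dots+m^2=\frac{m(m+1)(2m+1)}{6},$$ and equivalently $\sum_{m\ge0}c_{2,m+1}x^m=\dfrac{1+x}{(1-x)^4}$.
   Context: A plabic tree is a plabic graph (planar graph in a disk, black/white internal vertices, boundary vertices $1,\dots,n$ labeled clockwise each incident to one edge, leafless) whose underlying graph is a tree; bipartite with boundary vertices $B_{bd}$ regarded as black and internal black vertices $B_{int}$; its type is $(k,n)$ with $k=1+\sum_{b\in B_{int}}(\deg b-2)$. A $(k,m)$-amplitree is a bipartite plabic tree of type $(k,km+1)$ which is $m$-balanced: for each edge $e$, writing $G\setminus\{e\}=G_1\sqcup G_2$ (each component receiving half of $e$), one has $1\le|B_{bd}\cap G_i|-m\sum_{b\in G_i\cap B_{int}}(\deg b-2)\le m$ for $i=1,2$ (degrees in $G$). Move-equivalence: generated by the plabic graph moves (square move; contracting/expanding adjacent internal vertices of the same color; inserting/removing degree-2 internal vertices); for trees only the latter two apply. -}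

module Defs where

open import Data.Nat using (ℕ; zero; suc; _+_; _*_; _∸_)
open import Data.Integer as ℤ using (ℤ; +_)
open import Data.List using (List; []; _∷_; _++_; length)
open import Data.List.Relation.Unary.All using (All)
open import Data.List.Relation.Unary.Any using (Any)
open import Data.Fin using (Fin)
open import Data.Product using (Σ; _×_; ∃)
open import Relation.Binary.PropositionalEquality using (_≡_; _≢_)
open import Relation.Binary.Construct.Closure.ReflexiveTransitive using (Star)
open import Relation.Binary.Construct.Closure.Symmetric using (SymClosure)
open import Relation.Nullary using (¬_)

-- A plabic tree with boundary vertices 1..n is encoded by the structure
-- hanging off boundary vertex 1: the tree 'PT' attached to the unique
-- edge at boundary vertex 1.  A 'node c ts' is an internal vertex of
-- colour c whose neighbours other than its parent are 'ts', listed in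
-- clockwise order starting after the parent.  A 'leaf' is a boundary
-- vertex; boundary vertices 2..n are the leaves in depth-first
-- (= clockwise) order, so the labelling is determined by the shape.
-- Two embeddings are isotopic iff they give the same PT.

data Colour : Set where
  black white : Colour

data PT : Set where
  leaf : PT
  node : Colour → List PT → PT

deg : List PT → ℕ
deg ts = suc (length ts)

mutual
  bd : PT → ℕ
  bd leaf = 1
  bd (node c ts) = bdL ts

  bdL : List PT → ℕ
  bdL [] = 0
  bdL (t ∷ ts) = bd t + bdL ts

mutual
  bl : PT → ℕ
  bl leaf = 0
  bl (node black ts) = (deg ts ∸ 2) + blL ts
  bl (node white ts) = blL ts

  blL : List PT → ℕ
  blL [] = 0
  blL (t ∷ ts) = bl t + blL ts

-- number of boundary vertices n of the plabic tree (boundary vertex 1 included)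
nB : PT → ℕ
nB t = suc (bd t)

kType : PT → ℕ
kType t = suc (bl t)

-- leafless: every internal vertex has degree ≥ 2, i.e. at least one child
data Leafless : PT → Set where
  leaf : Leafless leaf
  node : ∀ {c t ts} → All Leafless (t ∷ ts) → Leafless (node c (t ∷ ts))

-- bipartite, with all boundary vertices regarded as black.
-- 'BipBelow p t' : t is a well-coloured subtree whose parent has colour p.
data BipBelow : Colour → PT → Set where
  leaf : BipBelow white leaf
  nodeBW : ∀ {ts} → All (BipBelow white) ts → BipBelow black (node white ts)
  nodeWB : ∀ {ts} → All (BipBelow black) ts → BipBelow white (node black ts)

-- the parent of the root is boundary vertex 1, which is black
Bipartite : PT → Set
Bipartite t = BipBelow black t

-- 'SubtreeOf s t': s is the subtree below some edge of the tree t.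
-- The edges of the plabic tree are in bijection with the subtrees of t
-- (t itself corresponds to the edge at boundary vertex 1).
data SubtreeOf : PT → PT → Set where
  here  : ∀ {t} → SubtreeOf t t
  there : ∀ {s c ts} → Any (λ v → SubtreeOf s v) ts → SubtreeOf s (node c ts)

-- The m-balanced condition for the edge above subtree s inside t:
-- G₂ = s, G₁ = complement (containing boundary vertex 1).
Bal : ℕ → ℤ → ℤ → Set
Bal m nb sb = (+ 1 ℤ.≤ nb ℤ.- (+ m) ℤ.* sb) × (nb ℤ.- (+ m) ℤ.* sb ℤ.≤ + m)

Balanced : ℕ → PT → Set
Balanced m t = ∀ s → SubtreeOf s t →
    Bal m (+ bd s) (+ bl s)
  × Bal m (+ nB t ℤ.- + bd s) (+ bl t ℤ.- + bl s)

Amplitree : ℕ → ℕ → PT → Set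
Amplitree k m t =
  Leafless t × Bipartite t × kType t ≡ k × nB t ≡ k * m + 1 × Balanced m t

-- Moves on plabic trees (only these two kinds can apply to trees).

data Contract : PT → PT → Set where
  remove2  : ∀ c t → Contract (node c (t ∷ [])) t
  contract : ∀ c xs ys zs →
    Contract (node c (xs ++ node c ys ∷ zs)) (node c (xs ++ ys ++ zs))
  inside   : ∀ c xs s s′ zs → Contract s s′ →
    Contract (node c (xs ++ s ∷ zs)) (node c (xs ++ s′ ∷ zs))

Move : PT → PT → Set
Move s t = Leafless s × Leafless t × Contract s t

-- move-equivalence: equivalence closure of moves (insertion/expansion are
-- the inverses of removal/contraction), through plabic trees only
MoveEq : PT → PT → Set
MoveEq = Star (SymClosure Move)

NumClasses : ℕ → ℕ → ℕ → Set
NumClasses k m N = Σ (Fin N → PT) λ rep →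
    (∀ i → Amplitree k m (rep i))
  × (∀ i j → i ≢ j → ¬ MoveEq (rep i) (rep j))
  × (∀ t → Amplitree k m t → ∃ λ i → MoveEq t (rep i))

sumSq : ℕ → ℕ
sumSq zero = 0
sumSq (suc m) = sumSq m + suc m * suc m

-- A (2,m)-amplitree has exactly one black vertex of degree 3; its other black vertices have
-- degree 2.  Removing those and contracting the resulting white edges turns it into
-- canon (p , a , b , q): a white vertex carrying boundary vertex 1, p + q further boundary
-- vertices and a trivalent black vertex whose two other neighbours are white vertices with
-- a and b boundary vertices.  Since n = km + 1, an edge is balanced as soon as its side away
-- from boundary vertex 1 is; at the three edges of the black vertex this says exactly
-- a ≤ m, b ≤ m and m < a + b, while p + a + b + q = 2m.
--
-- Distinct canonical trees are not move-equivalent.  Read the boundary vertices (ℓ) and the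
-- turns between consecutive neighbours of black vertices of degree ≥ 3 (κ) in clockwise
-- order; a move changes this word only by κκ ↔ κ, and the reduced word of canon (p , a , b , q)
-- is ℓᵖ κ ℓᵃ κ ℓᵇ κ ℓ^q.
--
-- The admissible quadruples for m + 1 are those for m with a and b raised by one, together
-- with the (m + 1)² new ones with (a - 1) + (b - 1) = m and p + q = m.

{-# OPTIONS --safe #-}
module Submission where

open import Defs
open import Data.Empty using (⊥-elim)
open import Data.Fin using (Fin; toℕ; fromℕ<)
open import Data.Fin.Properties using (+↔⊎; *↔×; toℕ-injective; toℕ-fromℕ<; toℕ≤pred[n])
open import Data.Integer as ℤ using (+_; +≤+)
open import Data.Integer.Properties using (pos-*; m-n≡m⊖n; ⊖-≥; drop‿+≤+; i≤j⇒i-j≤0)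
import Data.Integer.Properties as ℤ
open import Data.List using (List; []; _∷_; _++_; foldr; replicate; length)
open import Data.List.Properties using (++-assoc; ++-identityʳ; foldr-++; ∷-injective; length-replicate)
open import Data.List.Relation.Unary.All using (All; []; _∷_; head)
import Data.List.Relation.Unary.All.Properties as All
open import Data.List.Relation.Unary.Any using (Any; here; there)
import Data.List.Relation.Unary.Any.Properties as Any
open import Data.Nat using (ℕ; zero; suc; _+_; _*_; _∸_; _≤_; _<_; s≤s; z≤n; s≤s⁻¹; _<?_)
open import Data.Nat.Properties
  using ( +-assoc; +-comm; +-identityʳ; +-suc; *-zeroʳ; *-identityʳ; *-distribˡ-+; suc-injective
        ; ≤-refl; ≤-trans; <⇒≤; <⇒≱; ≮⇒≥; <-irrefl; m≤m+n; m≤n+m; n≤1+n; m<m+n; m≤n⇒m<n∨m≡n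
        ; +-mono-≤; +-monoʳ-≤; +-monoˡ-≤; +-cancelˡ-≤; +-cancelʳ-≤; +-cancelˡ-≡
        ; m+n≡0⇒m≡0; m+n≡0⇒n≡0; m+[n∸m]≡n; m+n∸m≡n; m<n⇒0<n∸m; m≤n+o⇒m∸n≤o
        ; +-commutativeSemigroup; module ≤-Reasoning )
open import Algebra.Properties.CommutativeSemigroup +-commutativeSemigroup using (x∙yz≈y∙xz)
open import Data.Nat.Tactic.RingSolver using (solve-∀)
open import Data.Product using (_×_; _,_; proj₁; proj₂; ∃)
open import Data.Sum using (_⊎_; inj₁; inj₂)
open import Data.Sum.Function.Propositional using (_⊎-↔_)
open import Function using (_∘_; id; _↔_; _⇔_; mk⇔; Equivalence; Inverse; Injection)
open import Function.Construct.Composition using (_↔-∘_)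
open import Function.Properties.Inverse using (↔⇒↣; ↔-refl)
open import Relation.Binary.Bundles using (Setoid)
open import Relation.Binary.PropositionalEquality
import Relation.Binary.Reasoning.Setoid as SetoidReasoning
import Relation.Binary.Construct.Closure.ReflexiveTransitive as Star
open import Relation.Binary.Construct.Closure.ReflexiveTransitive using (ε; _◅_)
open import Relation.Binary.Construct.Closure.ReflexiveTransitive.Properties using (module StarReasoning)
import Relation.Binary.Construct.Closure.Symmetric as Sym
open import Relation.Binary.Construct.Closure.Symmetric using (SymClosure; fwd; bwd)
open import Relation.Nullary using (¬_; yes; no)

-- Counting boundary vertices and black degrees

leaves : ℕ → List PT
leaves n = replicate n leaf

fork : ℕ → ℕ → PT
fork a b = node black (node white (leaves a) ∷ node white (leaves b) ∷ [])

leaves-++ : ∀ m n → leaves (m + n) ≡ leaves m ++ leaves n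
leaves-++ zero    n = refl
leaves-++ (suc m) n = cong (leaf ∷_) (leaves-++ m n)

bdL-++ : ∀ xs ys → bdL (xs ++ ys) ≡ bdL xs + bdL ys
bdL-++ []       ys = refl
bdL-++ (x ∷ xs) ys = trans (cong (_+_ (bd x)) (bdL-++ xs ys)) (sym (+-assoc (bd x) _ _))

blL-++ : ∀ xs ys → blL (xs ++ ys) ≡ blL xs + blL ys
blL-++ []       ys = refl
blL-++ (x ∷ xs) ys = trans (cong (_+_ (bl x)) (blL-++ xs ys)) (sym (+-assoc (bl x) _ _))

bdL-leaves : ∀ n → bdL (leaves n) ≡ n
bdL-leaves zero    = refl
bdL-leaves (suc n) = cong suc (bdL-leaves n)

blL-leaves : ∀ n → blL (leaves n) ≡ 0
blL-leaves zero    = refl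
blL-leaves (suc n) = blL-leaves n

bd-fork : ∀ a b → bd (fork a b) ≡ a + b
bd-fork a b rewrite bdL-leaves a | bdL-leaves b = cong (_+_ a) (+-identityʳ b)

bl-fork : ∀ a b → bl (fork a b) ≡ 1
bl-fork a b rewrite blL-leaves a | blL-leaves b = refl

leafless-children : ∀ {c ts} → Leafless (node c ts) → All Leafless ts
leafless-children (node L) = L

leafless-child : ∀ {c} xs {s zs} → Leafless (node c (xs ++ s ∷ zs)) → Leafless s
leafless-child xs L = head (All.++⁻ʳ xs (leafless-children L))

leafless-node : ∀ {c} xs {t ts} → All Leafless (xs ++ t ∷ ts) → Leafless (node c (xs ++ t ∷ ts))
leafless-node []      L = node L
leafless-node (_ ∷ _) L = node L

leafless-leaves : ∀ {c} n → 0 < n → Leafless (node c (leaves n))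
leafless-leaves (suc n) _ = node (leaf ∷ All.replicate⁺ n leaf)

mutual
  bd-pos : ∀ {t} → Leafless t → 0 < bd t
  bd-pos leaf     = s≤s z≤n
  bd-pos (node L) = bdL-pos L

  bdL-pos : ∀ {t ts} → All Leafless (t ∷ ts) → 0 < bdL (t ∷ ts)
  bdL-pos {t} {ts} (Lt ∷ _) = ≤-trans (bd-pos Lt) (m≤m+n (bd t) (bdL ts))

mutual
  subtree-bd-≤ : ∀ {s t} → SubtreeOf s t → bd s ≤ bd t
  subtree-bd-≤ here       = ≤-refl
  subtree-bd-≤ (there s∈) = subtree∈-bd-≤ s∈

  subtree∈-bd-≤ : ∀ {s ts} → Any (SubtreeOf s) ts → bd s ≤ bdL ts
  subtree∈-bd-≤ (here s≤t) = ≤-trans (subtree-bd-≤ s≤t) (m≤m+n _ _)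
  subtree∈-bd-≤ (there s∈) = ≤-trans (subtree∈-bd-≤ s∈) (m≤n+m _ _)

mutual
  subtree-bl-≤ : ∀ {s t} → SubtreeOf s t → bl s ≤ bl t
  subtree-bl-≤ here                   = ≤-refl
  subtree-bl-≤ (there {c = white} s∈) = subtree∈-bl-≤ s∈
  subtree-bl-≤ (there {c = black} s∈) = ≤-trans (subtree∈-bl-≤ s∈) (m≤n+m _ _)

  subtree∈-bl-≤ : ∀ {s ts} → Any (SubtreeOf s) ts → bl s ≤ blL ts
  subtree∈-bl-≤ (here s≤t) = ≤-trans (subtree-bl-≤ s≤t) (m≤m+n _ _)
  subtree∈-bl-≤ (there s∈) = ≤-trans (subtree∈-bl-≤ s∈) (m≤n+m _ _)

mutual
  subtree-trans : ∀ {r s t} → SubtreeOf r s → SubtreeOf s t → SubtreeOf r t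
  subtree-trans r≤s here       = r≤s
  subtree-trans r≤s (there s∈) = there (subtree∈-trans r≤s s∈)

  subtree∈-trans : ∀ {r s ts} → SubtreeOf r s → Any (SubtreeOf s) ts → Any (SubtreeOf r) ts
  subtree∈-trans r≤s (here s≤t) = here (subtree-trans r≤s s≤t)
  subtree∈-trans r≤s (there s∈) = there (subtree∈-trans r≤s s∈)

-- The balance condition

Balℕ : ℕ → ℕ → ℕ → Set
Balℕ m x y = m * y < x × x ≤ m * y + m

pos-∸ : ∀ {x k} → k ≤ x → + (x ∸ k) ≡ + x ℤ.- + k
pos-∸ {x} {k} k≤x = sym (trans (m-n≡m⊖n x k) (⊖-≥ k≤x))

1≤x-k≤n⇔k<x≤k+n : ∀ k x n → ((+ 1 ℤ.≤ + x ℤ.- + k) × (+ x ℤ.- + k ℤ.≤ + n)) ⇔ (k < x × x ≤ k + n)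
1≤x-k≤n⇔k<x≤k+n k x n = mk⇔ to from
  where
    1≰0 : ¬ (+ 1 ℤ.≤ + 0)
    1≰0 (+≤+ ())

    to : (+ 1 ℤ.≤ + x ℤ.- + k) × (+ x ℤ.- + k ℤ.≤ + n) → k < x × x ≤ k + n
    to (lo , hi) with k <? x
    ... | no k≮x  = ⊥-elim (1≰0 (ℤ.≤-trans lo (i≤j⇒i-j≤0 (+≤+ (≮⇒≥ k≮x)))))
    ... | yes k<x = k<x , (begin
      x           ≡⟨ m+[n∸m]≡n (<⇒≤ k<x) ⟨
      k + (x ∸ k) ≤⟨ +-monoʳ-≤ k (drop‿+≤+ (subst (ℤ._≤ + n) (sym (pos-∸ (<⇒≤ k<x))) hi)) ⟩
      k + n       ∎)
      where open ≤-Reasoning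

    from : k < x × x ≤ k + n → (+ 1 ℤ.≤ + x ℤ.- + k) × (+ x ℤ.- + k ℤ.≤ + n)
    from (k<x , x≤k+n) rewrite sym (pos-∸ (<⇒≤ k<x)) =
      +≤+ (m<n⇒0<n∸m k<x) , +≤+ (m≤n+o⇒m∸n≤o x k x≤k+n)

Bal⇔Balℕ : ∀ m x y → Bal m (+ x) (+ y) ⇔ Balℕ m x y
Bal⇔Balℕ m x y = subst (λ z → ((+ 1 ℤ.≤ + x ℤ.- z) × (+ x ℤ.- z ℤ.≤ + m)) ⇔ Balℕ m x y)
  (pos-* m y) (1≤x-k≤n⇔k<x≤k+n (m * y) x m)

Balℕ-light : ∀ {m x} → Balℕ m x 0 ⇔ (0 < x × x ≤ m)
Balℕ-light {m} rewrite *-zeroʳ m = mk⇔ id id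

Balℕ-heavy : ∀ {m x} → Balℕ m x 1 ⇔ (m < x × x ≤ m + m)
Balℕ-heavy {m} rewrite *-identityʳ m = mk⇔ id id

complement-<⇔≤ : ∀ {u v s t} → u + v ≡ suc (s + t) → s < u ⇔ v ≤ t
complement-<⇔≤ {u} {v} {s} {t} total = mk⇔
  (λ s<u → +-cancelˡ-≤ (suc s) v t (begin
    suc s + v ≤⟨ +-monoˡ-≤ v s<u ⟩
    u + v     ≡⟨ total ⟩
    suc s + t ∎))
  (λ v≤t → +-cancelʳ-≤ t (suc s) u (begin
    suc s + t ≡⟨ total ⟨
    u + v     ≤⟨ +-monoʳ-≤ u v≤t ⟩
    u + t     ∎))
  where open ≤-Reasoning

Balℕ-complement : ∀ {m x y x′ y′} → x + x′ ≡ suc (m * y + (m * y′ + m)) → Balℕ m x y → Balℕ m x′ y′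
Balℕ-complement {m} {x} {y} {x′} {y′} total (lo , hi) =
  Equivalence.from (complement-<⇔≤ total′) hi , Equivalence.to (complement-<⇔≤ total) lo
  where
    total′ : x′ + x ≡ suc (m * y′ + (m * y + m))
    total′ = trans (+-comm x′ x) (trans total (cong suc (x∙yz≈y∙xz (m * y) (m * y′) m)))

edge-balanced : ∀ {k m s t} → kType t ≡ k → nB t ≡ k * m + 1 → SubtreeOf s t → Balℕ m (bd s) (bl s) →
  Bal m (+ bd s) (+ bl s) × Bal m (+ nB t ℤ.- + bd s) (+ bl t ℤ.- + bl s)
edge-balanced {m = m} {s} {t} refl nB≡ s≤t bal =
  Equivalence.from (Bal⇔Balℕ m _ _) bal ,
  subst₂ (Bal m) (pos-∸ bd≤) (pos-∸ bl≤)
    (Equivalence.from (Bal⇔Balℕ m _ _) (Balℕ-complement {m} {y = bl s} {y′ = d} total bal))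
  where
    bd≤ : bd s ≤ nB t
    bd≤ = ≤-trans (subtree-bd-≤ s≤t) (n≤1+n _)
    bl≤ : bl s ≤ bl t
    bl≤ = subtree-bl-≤ s≤t
    d = bl t ∸ bl s
    total : bd s + (nB t ∸ bd s) ≡ suc (m * bl s + (m * d + m))
    total = begin
      bd s + (nB t ∸ bd s)         ≡⟨ m+[n∸m]≡n bd≤ ⟩
      nB t                         ≡⟨ nB≡ ⟩
      suc (bl t) * m + 1           ≡⟨ cong (λ y → suc y * m + 1) (m+[n∸m]≡n bl≤) ⟨
      suc (bl s + d) * m + 1       ≡⟨ distribute (bl s) d m ⟩
      suc (m * bl s + (m * d + m)) ∎
      where
        open ≡-Reasoning
        distribute : ∀ y d m → suc (y + d) * m + 1 ≡ suc (m * y + (m * d + m))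
        distribute = solve-∀

-- Normal form under moves

inside-move : ∀ {c xs zs s s′} → All Leafless xs → All Leafless zs → Move s s′ →
  Move (node c (xs ++ s ∷ zs)) (node c (xs ++ s′ ∷ zs))
inside-move {c} {xs} {zs} Lxs Lzs (Ls , Ls′ , s→s′) =
  leafless-node xs (All.++⁺ Lxs (Ls ∷ Lzs)) , leafless-node xs (All.++⁺ Lxs (Ls′ ∷ Lzs)) ,
  inside c xs _ _ zs s→s′

inside-moveEq : ∀ {c xs zs s s′} → All Leafless xs → All Leafless zs → MoveEq s s′ →
  MoveEq (node c (xs ++ s ∷ zs)) (node c (xs ++ s′ ∷ zs))
inside-moveEq {c} {xs} {zs} Lxs Lzs =
  Star.gmap (λ s → node c (xs ++ s ∷ zs)) (Sym.gmap _ (inside-move Lxs Lzs))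

infix 4 _≈ʷ_
record _≈ʷ_ (ts ts′ : List PT) : Set where
  field
    leafless  : All Leafless ts
    leafless′ : All Leafless ts′
    inContext : ∀ {xs zs} → All Leafless xs → All Leafless zs →
                MoveEq (node white (xs ++ ts ++ zs)) (node white (xs ++ ts′ ++ zs))
open _≈ʷ_

≈ʷ-refl : ∀ {ts} → All Leafless ts → ts ≈ʷ ts
≈ʷ-refl L = record { leafless = L ; leafless′ = L ; inContext = λ _ _ → ε }

≈ʷ-trans : ∀ {ts us vs} → ts ≈ʷ us → us ≈ʷ vs → ts ≈ʷ vs
≈ʷ-trans T U = record
  { leafless  = leafless T
  ; leafless′ = leafless′ U
  ; inContext = λ Lxs Lzs → inContext T Lxs Lzs Star.◅◅ inContext U Lxs Lzs
  }

infixr 5 _++ʷ_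
_++ʷ_ : ∀ {xs xs′ ys ys′} → xs ≈ʷ xs′ → ys ≈ʷ ys′ → xs ++ ys ≈ʷ xs′ ++ ys′
_++ʷ_ {xs} {xs′} {ys} {ys′} X Y = record
  { leafless  = All.++⁺ (leafless X) (leafless Y)
  ; leafless′ = All.++⁺ (leafless′ X) (leafless′ Y)
  ; inContext = λ {us} {zs} Lus Lzs → begin
      node white (us ++ (xs ++ ys) ++ zs)   ≡⟨ cong (node white ∘ (us ++_)) (++-assoc xs ys zs) ⟩
      node white (us ++ xs ++ ys ++ zs)     ⟶*⟨ inContext X Lus (All.++⁺ (leafless Y) Lzs) ⟩
      node white (us ++ xs′ ++ ys ++ zs)    ≡⟨ cong (node white) (++-assoc us xs′ _) ⟨
      node white ((us ++ xs′) ++ ys ++ zs)  ⟶*⟨ inContext Y (All.++⁺ Lus (leafless′ X)) Lzs ⟩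
      node white ((us ++ xs′) ++ ys′ ++ zs) ≡⟨ cong (node white) (++-assoc us xs′ _) ⟩
      node white (us ++ xs′ ++ ys′ ++ zs)   ≡⟨ cong (node white ∘ (us ++_)) (++-assoc xs′ ys′ zs) ⟨
      node white (us ++ (xs′ ++ ys′) ++ zs) ∎
  }
  where open StarReasoning (SymClosure Move)

moveEq⇒≈ʷ : ∀ {s s′} → Leafless s → Leafless s′ → MoveEq s s′ → s ∷ [] ≈ʷ s′ ∷ []
moveEq⇒≈ʷ Ls Ls′ s~s′ = record
  { leafless = Ls ∷ [] ; leafless′ = Ls′ ∷ [] ; inContext = λ Lxs Lzs → inside-moveEq Lxs Lzs s~s′ }

≈ʷ⇒moveEq : ∀ {ts ts′} → ts ≈ʷ ts′ → MoveEq (node white ts) (node white ts′)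
≈ʷ⇒moveEq {ts} {ts′} T =
  subst₂ (λ us us′ → MoveEq (node white us) (node white us′)) (++-identityʳ ts) (++-identityʳ ts′)
    (inContext T [] [])

absorb : ∀ {us} → Leafless (node white us) → node black (node white us ∷ []) ∷ [] ≈ʷ us
absorb {us} Lw@(node Lus) = record
  { leafless  = node (Lw ∷ []) ∷ []
  ; leafless′ = Lus
  ; inContext = λ {xs} {zs} Lxs Lzs →
      fwd (inside-move Lxs Lzs (node (Lw ∷ []) , Lw , remove2 black (node white us)))
      ◅ fwd ( leafless-node xs (All.++⁺ Lxs (Lw ∷ Lzs))
            , leafless-node xs (All.++⁺ Lxs (All.++⁺ Lus Lzs))
            , contract white xs us zs )
      ◅ ε
  }

flatten : ∀ {ts} → All (BipBelow white) ts → All Leafless ts → blL ts ≡ 0 → ts ≈ʷ leaves (bdL ts)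
flatten []         []      _ = ≈ʷ-refl []
flatten (leaf ∷ B) (_ ∷ L) e = ≈ʷ-refl (leaf ∷ []) ++ʷ flatten B L e
flatten {_ ∷ ts} (nodeWB (nodeBW {us} Bus ∷ []) ∷ B) (node (Lw ∷ []) ∷ L) e =
  subst (node black (node white us ∷ []) ∷ ts ≈ʷ_) leaves-bdL
    (≈ʷ-trans (absorb Lw) (flatten Bus (leafless-children Lw) blL-us≡0) ++ʷ flatten B L blL-ts≡0)
  where
    blL-us≡0 : blL us ≡ 0
    blL-us≡0 = trans (sym (+-identityʳ _)) (m+n≡0⇒m≡0 (blL us + 0) e)
    blL-ts≡0 : blL ts ≡ 0
    blL-ts≡0 = m+n≡0⇒n≡0 (blL us + 0) e
    leaves-bdL : leaves (bdL us) ++ leaves (bdL ts) ≡ leaves (bdL us + 0 + bdL ts)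
    leaves-bdL = trans (sym (leaves-++ (bdL us) (bdL ts)))
                       (cong (λ n → leaves (n + bdL ts)) (sym (+-identityʳ _)))
flatten (nodeWB []          ∷ _) (() ∷ _) _
flatten (nodeWB (_ ∷ _ ∷ _) ∷ _) _        ()

record NormalForm (ts : List PT) : Set where
  field
    p q     : ℕ
    us₁ us₂ : List PT
    fork∈   : Any (SubtreeOf (node black (node white us₁ ∷ node white us₂ ∷ []))) ts
    flat₁   : blL us₁ ≡ 0
    flat₂   : blL us₂ ≡ 0
    size    : p + (bdL us₁ + bdL us₂ + q) ≡ bdL ts
    ≈canon  : ts ≈ʷ leaves p ++ fork (bdL us₁) (bdL us₂) ∷ leaves q

prepend-flat : ∀ {xs ts} → xs ≈ʷ leaves (bdL xs) → NormalForm ts → NormalForm (xs ++ ts)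
prepend-flat {xs} {ts} X N = record
  { p = bdL xs + p ; q = q ; us₁ = us₁ ; us₂ = us₂
  ; fork∈ = Any.++⁺ʳ xs fork∈ ; flat₁ = flat₁ ; flat₂ = flat₂
  ; size = trans (+-assoc (bdL xs) p _) (trans (cong (_+_ (bdL xs)) size) (sym (bdL-++ xs ts)))
  ; ≈canon = subst (xs ++ ts ≈ʷ_)
      (trans (sym (++-assoc (leaves (bdL xs)) (leaves p) _)) (cong (_++ _) (sym (leaves-++ (bdL xs) p))))
      (X ++ʷ ≈canon)
  }
  where open NormalForm N

append-flat : ∀ {ts ys} → NormalForm ts → ys ≈ʷ leaves (bdL ys) → NormalForm (ts ++ ys)
append-flat {ts} {ys} N Y = record
  { p = p ; q = q + bdL ys ; us₁ = us₁ ; us₂ = us₂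
  ; fork∈ = Any.++⁺ˡ fork∈ ; flat₁ = flat₁ ; flat₂ = flat₂
  ; size = begin
      p + (bdL us₁ + bdL us₂ + (q + bdL ys)) ≡⟨ cong (_+_ p) (+-assoc _ q (bdL ys)) ⟨
      p + (bdL us₁ + bdL us₂ + q + bdL ys)   ≡⟨ +-assoc p _ (bdL ys) ⟨
      p + (bdL us₁ + bdL us₂ + q) + bdL ys   ≡⟨ cong (_+ bdL ys) size ⟩
      bdL ts + bdL ys                        ≡⟨ bdL-++ ts ys ⟨
      bdL (ts ++ ys)                         ∎
  ; ≈canon = subst (ts ++ ys ≈ʷ_)
      (trans (++-assoc (leaves p) (fork (bdL us₁) (bdL us₂) ∷ leaves q) (leaves (bdL ys)))
             (cong (λ zs → leaves p ++ _ ∷ zs) (sym (leaves-++ q _))))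
      (≈canon ++ʷ Y)
  }
  where
    open NormalForm N
    open ≡-Reasoning

absorb-normal : ∀ {us} → Leafless (node white us) → NormalForm us →
  NormalForm (node black (node white us ∷ []) ∷ [])
absorb-normal Lw N = record
  { p = p ; q = q ; us₁ = us₁ ; us₂ = us₂
  ; fork∈ = here (there (here (there fork∈))) ; flat₁ = flat₁ ; flat₂ = flat₂
  ; size = trans size (sym (trans (+-identityʳ _) (+-identityʳ _)))
  ; ≈canon = ≈ʷ-trans (absorb Lw) ≈canon
  }
  where open NormalForm N

fork-normal : ∀ {us₁ us₂} → All (BipBelow white) us₁ → All (BipBelow white) us₂ →
  Leafless (node white us₁) → Leafless (node white us₂) → blL us₁ ≡ 0 → blL us₂ ≡ 0 →
  NormalForm (node black (node white us₁ ∷ node white us₂ ∷ []) ∷ [])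
fork-normal {us₁} {us₂} B₁ B₂ L₁ L₂ flat₁ flat₂ = record
  { p = 0 ; q = 0 ; us₁ = us₁ ; us₂ = us₂
  ; fork∈ = here here ; flat₁ = flat₁ ; flat₂ = flat₂
  ; size = cong (λ b → bdL us₁ + b + 0) (sym (+-identityʳ (bdL us₂)))
  ; ≈canon = moveEq⇒≈ʷ (node (L₁ ∷ L₂ ∷ [])) (node (L₁′ ∷ L₂′ ∷ []))
      (inside-moveEq [] (L₂ ∷ []) (≈ʷ⇒moveEq (flatten B₁ (leafless-children L₁) flat₁))
       Star.◅◅ inside-moveEq (L₁′ ∷ []) [] (≈ʷ⇒moveEq (flatten B₂ (leafless-children L₂) flat₂)))
  }
  where
    L₁′ = leafless-leaves (bdL us₁) (bd-pos L₁)
    L₂′ = leafless-leaves (bdL us₂) (bd-pos L₂)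

m+n≡1⇒ : ∀ m n → m + n ≡ 1 → (m ≡ 0 × n ≡ 1) ⊎ (m ≡ 1 × n ≡ 0)
m+n≡1⇒ zero          n       e  = inj₁ (refl , e)
m+n≡1⇒ (suc zero)    zero    _  = inj₂ (refl , refl)
m+n≡1⇒ (suc zero)    (suc n) ()
m+n≡1⇒ (suc (suc m)) n       ()

mutual
  normalise : ∀ {ts} → All (BipBelow white) ts → All Leafless ts → blL ts ≡ 1 → NormalForm ts
  normalise []         _       ()
  normalise (leaf ∷ B) (_ ∷ L) e = prepend-flat (≈ʷ-refl (leaf ∷ [])) (normalise B L e)
  normalise {t ∷ ts} (Bt@(nodeWB _) ∷ B) (Lt ∷ L) e with m+n≡1⇒ (bl t) (blL ts) e
  ... | inj₁ (e₁ , e₂) = prepend-flat (flatten (Bt ∷ []) (Lt ∷ []) (cong (_+ 0) e₁)) (normalise B L e₂)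
  ... | inj₂ (e₁ , e₂) = append-flat (normalise-black Bt Lt e₁) (flatten B L e₂)

  normalise-black : ∀ {vs} → BipBelow white (node black vs) → Leafless (node black vs) →
    bl (node black vs) ≡ 1 → NormalForm (node black vs ∷ [])
  normalise-black (nodeWB (nodeBW B ∷ [])) (node (Lw ∷ [])) e =
    absorb-normal Lw (normalise B (leafless-children Lw) (trans (sym (+-identityʳ _)) e))
  normalise-black (nodeWB (nodeBW {us₁} B₁ ∷ nodeBW B₂ ∷ [])) (node (L₁ ∷ L₂ ∷ [])) e =
    fork-normal B₁ B₂ L₁ L₂ (m+n≡0⇒m≡0 (blL us₁) flat)
                            (trans (sym (+-identityʳ _)) (m+n≡0⇒n≡0 (blL us₁) flat))
    where flat = suc-injective e
  normalise-black (nodeWB (_ ∷ _ ∷ _ ∷ _)) _ ()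

-- A move invariant

data Letter : Set where
  ℓ κ : Letter

mutual
  word : PT → List Letter
  word leaf            = ℓ ∷ []
  word (node white ts) = words ts
  word (node black ts) = blackWord ts

  words : List PT → List Letter
  words []       = []
  words (t ∷ ts) = word t ++ words ts

  turns : List PT → List Letter
  turns []       = []
  turns (t ∷ ts) = word t ++ κ ∷ turns ts

  blackWord : List PT → List Letter
  blackWord (t ∷ []) = word t
  blackWord ts       = κ ∷ turns ts

words-++ : ∀ xs ys → words (xs ++ ys) ≡ words xs ++ words ys
words-++ []       ys = refl
words-++ (x ∷ xs) ys = trans (cong (word x ++_) (words-++ xs ys)) (sym (++-assoc (word x) _ _))

turns-++ : ∀ xs ys → turns (xs ++ ys) ≡ turns xs ++ turns ys
turns-++ []       ys = refl
turns-++ (x ∷ xs) ys =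
  trans (cong (λ w → word x ++ κ ∷ w) (turns-++ xs ys)) (sym (++-assoc (word x) _ _))

blackWord-crowded : ∀ xs zs → (xs ≡ [] × zs ≡ []) ⊎
  (∀ y ys → blackWord (xs ++ (y ∷ ys) ++ zs) ≡ κ ∷ turns (xs ++ (y ∷ ys) ++ zs))
blackWord-crowded []          []      = inj₁ (refl , refl)
blackWord-crowded []          (_ ∷ _) = inj₂ λ { _ [] → refl ; _ (_ ∷ _) → refl }
blackWord-crowded (_ ∷ [])    _       = inj₂ λ _ _ → refl
blackWord-crowded (_ ∷ _ ∷ _) _       = inj₂ λ _ _ → refl

infixr 5 _◁_
_◁_ : Letter → List Letter → List Letter
κ ◁ κ ∷ w = κ ∷ w
x ◁ w     = x ∷ w

reduce : List Letter → List Letter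
reduce = foldr _◁_ []

κ◁-idem : ∀ w → κ ◁ κ ◁ w ≡ κ ◁ w
κ◁-idem []      = refl
κ◁-idem (ℓ ∷ _) = refl
κ◁-idem (κ ∷ _) = refl

foldr-◁ : ∀ z x w → foldr _◁_ z (x ◁ w) ≡ x ◁ foldr _◁_ z w
foldr-◁ z ℓ w       = refl
foldr-◁ z κ []      = refl
foldr-◁ z κ (ℓ ∷ w) = refl
foldr-◁ z κ (κ ∷ w) = sym (κ◁-idem (foldr _◁_ z w))

foldr-reduce : ∀ z w → foldr _◁_ z (reduce w) ≡ foldr _◁_ z w
foldr-reduce z []      = refl
foldr-reduce z (x ∷ w) = trans (foldr-◁ z x (reduce w)) (cong (x ◁_) (foldr-reduce z w))

infix 4 _≈_
record _≈_ (u w : List Letter) : Set where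
  constructor reduces-to-same
  field same-reduct : reduce u ≡ reduce w
open _≈_

≈-setoid : Setoid _ _
≈-setoid = record
  { Carrier       = List Letter
  ; _≈_           = _≈_
  ; isEquivalence = record
    { refl  = reduces-to-same refl
    ; sym   = λ u≈w → reduces-to-same (sym (same-reduct u≈w))
    ; trans = λ u≈v v≈w → reduces-to-same (trans (same-reduct u≈v) (same-reduct v≈w))
    }
  }

module ≈-Reasoning = SetoidReasoning ≈-setoid
open Setoid ≈-setoid using () renaming (refl to ≈-refl; sym to ≈-sym; trans to ≈-trans)

≡⇒≈ : ∀ {u w} → u ≡ w → u ≈ w
≡⇒≈ refl = ≈-refl

++-cong : ∀ {u u′ w w′} → u ≈ u′ → w ≈ w′ → u ++ w ≈ u′ ++ w′
++-cong {u} {u′} {w} {w′} (reduces-to-same u~) (reduces-to-same w~) = reduces-to-same (begin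
  reduce (u ++ w)                   ≡⟨ foldr-++ _◁_ [] u w ⟩
  foldr _◁_ (reduce w) u            ≡⟨ cong (λ z → foldr _◁_ z u) w~ ⟩
  foldr _◁_ (reduce w′) u           ≡⟨ foldr-reduce _ u ⟨
  foldr _◁_ (reduce w′) (reduce u)  ≡⟨ cong (foldr _◁_ (reduce w′)) u~ ⟩
  foldr _◁_ (reduce w′) (reduce u′) ≡⟨ foldr-reduce _ u′ ⟩
  foldr _◁_ (reduce w′) u′          ≡⟨ foldr-++ _◁_ [] u′ w′ ⟨
  reduce (u′ ++ w′)                 ∎)
  where open ≡-Reasoning

prefix-cong : ∀ u {w w′} → w ≈ w′ → u ++ w ≈ u ++ w′
prefix-cong u = ++-cong ≈-refl

κ∷turns-absorbs-κ : ∀ ts w → κ ∷ turns ts ++ κ ∷ w ≈ κ ∷ turns ts ++ w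
κ∷turns-absorbs-κ []       w = reduces-to-same (κ◁-idem (reduce w))
κ∷turns-absorbs-κ (t ∷ ts) w = begin
  κ ∷ (word t ++ κ ∷ turns ts) ++ κ ∷ w ≡⟨ cong (κ ∷_) (++-assoc (word t) _ _) ⟩
  (κ ∷ word t) ++ κ ∷ turns ts ++ κ ∷ w ≈⟨ prefix-cong (κ ∷ word t) (κ∷turns-absorbs-κ ts w) ⟩
  (κ ∷ word t) ++ κ ∷ turns ts ++ w     ≡⟨ cong (κ ∷_) (++-assoc (word t) _ _) ⟨
  κ ∷ (word t ++ κ ∷ turns ts) ++ w     ∎
  where open ≈-Reasoning

turns-absorbs-κ : ∀ t ts w → turns (t ∷ ts) ++ κ ∷ w ≈ turns (t ∷ ts) ++ w
turns-absorbs-κ t ts w = begin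
  (word t ++ κ ∷ turns ts) ++ κ ∷ w ≡⟨ ++-assoc (word t) _ _ ⟩
  word t ++ κ ∷ turns ts ++ κ ∷ w   ≈⟨ prefix-cong (word t) (κ∷turns-absorbs-κ ts w) ⟩
  word t ++ κ ∷ turns ts ++ w       ≡⟨ ++-assoc (word t) _ _ ⟨
  (word t ++ κ ∷ turns ts) ++ w     ∎
  where open ≈-Reasoning

blackWord-inside : ∀ xs y ys w →
  κ ∷ turns xs ++ blackWord (y ∷ ys) ++ κ ∷ w ≈ κ ∷ turns xs ++ turns (y ∷ ys) ++ w
blackWord-inside xs y []        w =
  ≡⇒≈ (cong (λ u → κ ∷ turns xs ++ u) (sym (++-assoc (word y) (κ ∷ []) w)))
blackWord-inside xs y (y′ ∷ ys) w = begin
  κ ∷ turns xs ++ κ ∷ turns Y ++ κ ∷ w ≈⟨ κ∷turns-absorbs-κ xs _ ⟩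
  κ ∷ turns xs ++ turns Y ++ κ ∷ w     ≈⟨ prefix-cong (κ ∷ turns xs) (turns-absorbs-κ y (y′ ∷ ys) w) ⟩
  κ ∷ turns xs ++ turns Y ++ w         ∎
  where
    open ≈-Reasoning
    Y = y ∷ y′ ∷ ys

word-contract : ∀ {s t} → Leafless s → Contract s t → word s ≈ word t
word-contract _ (remove2 white t) = ≡⇒≈ (++-identityʳ (word t))
word-contract _ (remove2 black t) = ≈-refl
word-contract _ (contract white xs ys zs) = ≡⇒≈ (begin
  words (xs ++ node white ys ∷ zs) ≡⟨ words-++ xs _ ⟩
  words xs ++ words ys ++ words zs ≡⟨ cong (words xs ++_) (words-++ ys zs) ⟨
  words xs ++ words (ys ++ zs)     ≡⟨ words-++ xs _ ⟨
  words (xs ++ ys ++ zs)           ∎)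
  where open ≡-Reasoning
word-contract L (contract black xs ys zs) with leafless-child xs L | blackWord-crowded xs zs
... | _ | inj₁ (refl , refl) = ≡⇒≈ (cong blackWord (sym (++-identityʳ ys)))
... | node {t = y} {ts = ys′} _ | inj₂ crowded = begin
  blackWord (xs ++ node black Y ∷ zs)         ≡⟨ crowded (node black Y) [] ⟩
  κ ∷ turns (xs ++ node black Y ∷ zs)         ≡⟨ cong (κ ∷_) (turns-++ xs _) ⟩
  κ ∷ turns xs ++ blackWord Y ++ κ ∷ turns zs ≈⟨ blackWord-inside xs y ys′ (turns zs) ⟩
  κ ∷ turns xs ++ turns Y ++ turns zs         ≡⟨ cong (λ u → κ ∷ turns xs ++ u) (turns-++ Y zs) ⟨
  κ ∷ turns xs ++ turns (Y ++ zs)             ≡⟨ cong (κ ∷_) (turns-++ xs _) ⟨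
  κ ∷ turns (xs ++ Y ++ zs)                   ≡⟨ crowded y ys′ ⟨
  blackWord (xs ++ Y ++ zs)                   ∎
  where
    open ≈-Reasoning
    Y = y ∷ ys′
word-contract L (inside white xs s s′ zs c) = begin
  words (xs ++ s ∷ zs)            ≡⟨ words-++ xs _ ⟩
  words xs ++ word s ++ words zs  ≈⟨ prefix-cong (words xs) (++-cong s≈s′ ≈-refl) ⟩
  words xs ++ word s′ ++ words zs ≡⟨ words-++ xs _ ⟨
  words (xs ++ s′ ∷ zs)           ∎
  where
    open ≈-Reasoning
    s≈s′ = word-contract (leafless-child xs L) c
word-contract L (inside black xs s s′ zs c) with blackWord-crowded xs zs
... | inj₁ (refl , refl) = word-contract (leafless-child [] L) c
... | inj₂ crowded = begin
  blackWord (xs ++ s ∷ zs)                ≡⟨ trans (crowded s []) (cong (κ ∷_) (turns-++ xs _)) ⟩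
  κ ∷ turns xs ++ word s ++ κ ∷ turns zs  ≈⟨ prefix-cong (κ ∷ turns xs) (++-cong s≈s′ ≈-refl) ⟩
  κ ∷ turns xs ++ word s′ ++ κ ∷ turns zs ≡⟨ trans (crowded s′ []) (cong (κ ∷_) (turns-++ xs _)) ⟨
  blackWord (xs ++ s′ ∷ zs)               ∎
  where
    open ≈-Reasoning
    s≈s′ = word-contract (leafless-child xs L) c

word-moveEq : ∀ {s t} → MoveEq s t → word s ≈ word t
word-moveEq ε                       = ≈-refl
word-moveEq (fwd (Ls , _ , c) ◅ st) = ≈-trans (word-contract Ls c) (word-moveEq st)
word-moveEq (bwd (Lt , _ , c) ◅ st) = ≈-trans (≈-sym (word-contract Lt c)) (word-moveEq st)

-- Canonical amplitrees

Quad : Set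
Quad = ℕ × ℕ × ℕ × ℕ

canon : Quad → PT
canon (p , a , b , q) = node white (leaves p ++ fork a b ∷ leaves q)

data Admissible (m : ℕ) : Quad → Set where
  admissible : ∀ {p a b q} → a ≤ m → b ≤ m → m < a + b → p + (a + b + q) ≡ m + m →
    Admissible m (p , a , b , q)

admissible-positive : ∀ {m p a b q} → Admissible m (p , a , b , q) → 0 < a × 0 < b
admissible-positive {a = zero} (admissible _ b≤m m<b _) = ⊥-elim (<⇒≱ m<b b≤m)
admissible-positive {m} {a = a@(suc _)} {b = zero} (admissible a≤m _ m<a+0 _) =
  ⊥-elim (<⇒≱ (subst (m <_) (+-identityʳ a) m<a+0) a≤m)
admissible-positive {a = suc _} {b = suc _} _ = s≤s z≤n , s≤s z≤n

bd-canon : ∀ p a b q → bd (canon (p , a , b , q)) ≡ p + (a + b + q)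
bd-canon p a b q = trans (bdL-++ (leaves p) (fork a b ∷ leaves q))
  (cong₂ _+_ (bdL-leaves p) (cong₂ _+_ (bd-fork a b) (bdL-leaves q)))

bl-canon : ∀ p a b q → bl (canon (p , a , b , q)) ≡ 1
bl-canon p a b q = trans (blL-++ (leaves p) (fork a b ∷ leaves q))
  (cong₂ _+_ (blL-leaves p) (cong₂ _+_ (bl-fork a b) (blL-leaves q)))

2*m+1≡1+[m+m] : ∀ m → 2 * m + 1 ≡ suc (m + m)
2*m+1≡1+[m+m] = solve-∀

Balℕ-in-leaves : ∀ {m s} n → 0 < m → Any (SubtreeOf s) (leaves n) → Balℕ m (bd s) (bl s)
Balℕ-in-leaves (suc n) 0<m (here here) = Equivalence.from Balℕ-light (s≤s z≤n , 0<m)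
Balℕ-in-leaves (suc n) 0<m (there s∈) = Balℕ-in-leaves n 0<m s∈

Balℕ-in-white-leaves : ∀ {m s n} → 0 < n → n ≤ m → SubtreeOf s (node white (leaves n)) →
  Balℕ m (bd s) (bl s)
Balℕ-in-white-leaves {n = n} 0<n n≤m here rewrite bdL-leaves n | blL-leaves n =
  Equivalence.from Balℕ-light (0<n , n≤m)
Balℕ-in-white-leaves {n = n} 0<n n≤m (there s∈) = Balℕ-in-leaves n (≤-trans 0<n n≤m) s∈

Balℕ-in-canon : ∀ {m Q s} → Admissible m Q → SubtreeOf s (canon Q) → Balℕ m (bd s) (bl s)
Balℕ-in-canon {m} adm@(admissible {p} {a} {b} {q} a≤m b≤m m<a+b size) = below-canon
  where
    0<a = proj₁ (admissible-positive adm)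
    0<b = proj₂ (admissible-positive adm)
    0<m = ≤-trans 0<a a≤m

    below-fork : ∀ {s} → SubtreeOf s (fork a b) → Balℕ m (bd s) (bl s)
    below-fork here rewrite bd-fork a b | bl-fork a b =
      Equivalence.from Balℕ-heavy (m<a+b , +-mono-≤ a≤m b≤m)
    below-fork (there (here s≤w))         = Balℕ-in-white-leaves 0<a a≤m s≤w
    below-fork (there (there (here s≤w))) = Balℕ-in-white-leaves 0<b b≤m s≤w

    below-canon : ∀ {s} → SubtreeOf s (canon (p , a , b , q)) → Balℕ m (bd s) (bl s)
    below-canon here rewrite bd-canon p a b q | size | bl-canon p a b q =
      Equivalence.from Balℕ-heavy (m<m+n m 0<m , ≤-refl)
    below-canon (there s∈) with Any.++⁻ (leaves p) s∈
    ... | inj₁ s∈p         = Balℕ-in-leaves p 0<m s∈p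
    ... | inj₂ (here s≤f)  = below-fork s≤f
    ... | inj₂ (there s∈q) = Balℕ-in-leaves q 0<m s∈q

canon-amplitree : ∀ {m Q} → Admissible m Q → Amplitree 2 m (canon Q)
canon-amplitree {m} adm@(admissible {p} {a} {b} {q} _ _ _ size) =
  leafless-node (leaves p)
    (All.++⁺ (All.replicate⁺ p leaf)
      (node (leafless-leaves a 0<a ∷ leafless-leaves b 0<b ∷ []) ∷ All.replicate⁺ q leaf)) ,
  nodeBW (All.++⁺ (All.replicate⁺ p leaf)
    (nodeWB (nodeBW (All.replicate⁺ a leaf) ∷ nodeBW (All.replicate⁺ b leaf) ∷ [])
     ∷ All.replicate⁺ q leaf)) ,
  kType≡2 ,
  nB≡ ,
  λ s s≤canon → edge-balanced kType≡2 nB≡ s≤canon (Balℕ-in-canon adm s≤canon)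
  where
    0<a = proj₁ (admissible-positive adm)
    0<b = proj₂ (admissible-positive adm)
    kType≡2 : kType (canon (p , a , b , q)) ≡ 2
    kType≡2 = cong suc (bl-canon p a b q)
    nB≡ : nB (canon (p , a , b , q)) ≡ 2 * m + 1
    nB≡ = trans (cong suc (trans (bd-canon p a b q) size)) (sym (2*m+1≡1+[m+m] m))

amplitree-normal-form : ∀ {m t} → Amplitree 2 m t → ∃ λ Q → Admissible m Q × MoveEq t (canon Q)
amplitree-normal-form {m} {node white ts} (L , nodeBW B , kType≡2 , nB≡ , balanced) =
  (p , a , b , q) , admissible a≤m b≤m m<a+b size′ , ≈ʷ⇒moveEq ≈canon
  where
    open NormalForm (normalise B (leafless-children L) (suc-injective kType≡2))
    a = bdL us₁
    b = bdL us₂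

    below : ∀ {s} → SubtreeOf s (node white ts) → Balℕ m (bd s) (bl s)
    below s≤t = Equivalence.to (Bal⇔Balℕ m _ _) (proj₁ (balanced _ s≤t))

    fork≤t : SubtreeOf (node black (node white us₁ ∷ node white us₂ ∷ [])) (node white ts)
    fork≤t = there fork∈

    a≤m : a ≤ m
    a≤m = proj₂ (Equivalence.to Balℕ-light
            (subst (Balℕ m a) flat₁ (below (subtree-trans (there (here here)) fork≤t))))
    b≤m : b ≤ m
    b≤m = proj₂ (Equivalence.to Balℕ-light
            (subst (Balℕ m b) flat₂ (below (subtree-trans (there (there (here here))) fork≤t))))
    m<a+b : m < a + b
    m<a+b = proj₁ (Equivalence.to Balℕ-heavy
              (subst₂ (Balℕ m) (cong (_+_ a) (+-identityʳ b))
                 (cong suc (cong₂ _+_ flat₁ (cong (_+ 0) flat₂))) (below fork≤t)))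
    size′ : p + (a + b + q) ≡ m + m
    size′ = trans size (suc-injective (trans nB≡ (2*m+1≡1+[m+m] m)))

ℓ^ : ℕ → List Letter
ℓ^ n = replicate n ℓ

words-leaves : ∀ n → words (leaves n) ≡ ℓ^ n
words-leaves zero    = refl
words-leaves (suc n) = cong (ℓ ∷_) (words-leaves n)

reduce-ℓ^ : ∀ n w → reduce (ℓ^ n ++ w) ≡ ℓ^ n ++ reduce w
reduce-ℓ^ zero    w = refl
reduce-ℓ^ (suc n) w = cong (ℓ ∷_) (reduce-ℓ^ n w)

ℓ^-reduced : ∀ n → reduce (ℓ^ n) ≡ ℓ^ n
ℓ^-reduced zero    = refl
ℓ^-reduced (suc n) = cong (ℓ ∷_) (ℓ^-reduced n)

κℓ^-reduced : ∀ n → reduce (κ ∷ ℓ^ n) ≡ κ ∷ ℓ^ n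
κℓ^-reduced zero    = refl
κℓ^-reduced (suc n) = cong (λ w → κ ∷ ℓ ∷ w) (ℓ^-reduced n)

canon-word : ∀ p a b q → word (canon (p , a , b , q)) ≡ ℓ^ p ++ κ ∷ ℓ^ a ++ κ ∷ ℓ^ b ++ κ ∷ ℓ^ q
canon-word p a b q
  rewrite words-++ (leaves p) (fork a b ∷ leaves q)
        | words-leaves p | words-leaves a | words-leaves b | words-leaves q
        | ++-assoc (ℓ^ a) (κ ∷ ℓ^ b ++ κ ∷ []) (ℓ^ q) | ++-assoc (ℓ^ b) (κ ∷ []) (ℓ^ q) = refl

canon-reduct : ∀ p a b q →
  reduce (word (canon (p , suc a , suc b , q))) ≡ ℓ^ p ++ κ ∷ ℓ^ (suc a) ++ κ ∷ ℓ^ (suc b) ++ κ ∷ ℓ^ q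
canon-reduct p a b q
  rewrite canon-word p (suc a) (suc b) q
        | reduce-ℓ^ p (κ ∷ ℓ^ (suc a) ++ κ ∷ ℓ^ (suc b) ++ κ ∷ ℓ^ q)
        | reduce-ℓ^ a (κ ∷ ℓ^ (suc b) ++ κ ∷ ℓ^ q)
        | reduce-ℓ^ b (κ ∷ ℓ^ q)
        | κℓ^-reduced q = refl

ℓ^-κ-cancel : ∀ m n {u w} → ℓ^ m ++ κ ∷ u ≡ ℓ^ n ++ κ ∷ w → m ≡ n × u ≡ w
ℓ^-κ-cancel zero    zero    e = refl , proj₂ (∷-injective e)
ℓ^-κ-cancel (suc m) (suc n) e with ℓ^-κ-cancel m n (proj₂ (∷-injective e))
... | refl , u≡w = refl , u≡w

ℓ^-injective : ∀ {m n} → ℓ^ m ≡ ℓ^ n → m ≡ n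
ℓ^-injective {m} {n} e = trans (sym (length-replicate m)) (trans (cong length e) (length-replicate n))

canon-reduct-injective : ∀ {p a b q p′ a′ b′ q′} →
  reduce (word (canon (p , suc a , suc b , q))) ≡ reduce (word (canon (p′ , suc a′ , suc b′ , q′))) →
  _≡_ {A = Quad} (p , suc a , suc b , q) (p′ , suc a′ , suc b′ , q′)
canon-reduct-injective {p} {a} {b} {q} {p′} {a′} {b′} {q′} e
  with ℓ^-κ-cancel p p′ (trans (sym (canon-reduct p a b q)) (trans e (canon-reduct p′ a′ b′ q′)))
... | refl , e₁ with ℓ^-κ-cancel (suc a) (suc a′) e₁
... | refl , e₂ with ℓ^-κ-cancel (suc b) (suc b′) e₂
... | refl , e₃ = cong (λ q → p , suc a , suc b , q) (ℓ^-injective e₃)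

canon-separated : ∀ {m Q Q′} → Admissible m Q → Admissible m Q′ → MoveEq (canon Q) (canon Q′) → Q ≡ Q′
canon-separated adm adm′ Q~Q′ with admissible-positive adm | admissible-positive adm′
... | s≤s z≤n , s≤s z≤n | s≤s z≤n , s≤s z≤n = canon-reduct-injective (same-reduct (word-moveEq Q~Q′))

-- Counting admissible quadruples

splits : ∀ n → Fin (suc n) → ℕ × ℕ
splits n i = toℕ i , n ∸ toℕ i

splits-sum : ∀ n i → proj₁ (splits n i) + proj₂ (splits n i) ≡ n
splits-sum n i = m+[n∸m]≡n (toℕ≤pred[n] i)

splits-surjective : ∀ {n x y} → x + y ≡ n → ∃ λ i → splits n i ≡ (x , y)
splits-surjective {x = x} {y} refl =
  fromℕ< x<1+n , cong₂ _,_ (toℕ-fromℕ< x<1+n) (trans (cong (x + y ∸_) (toℕ-fromℕ< x<1+n)) (m+n∸m≡n x y))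
  where x<1+n = s≤s (m≤m+n x y)

shift : Quad → Quad
shift (p , a , b , q) = p , suc a , suc b , q

fresh : ∀ m → Fin (suc m) × Fin (suc m) → Quad
fresh m (i , j) = let (a , b) = splits m i ; (p , q) = splits m j in p , suc a , suc b , q

layers : ∀ m → Fin (sumSq (suc m)) ↔ (Fin (sumSq m) ⊎ Fin (suc m) × Fin (suc m))
layers m = (↔-refl ⊎-↔ *↔×) ↔-∘ +↔⊎ {sumSq m}

mutual
  enumerate : ∀ m → Fin (sumSq m) → Quad
  enumerate zero    ()
  enumerate (suc m) = enumerate-layer m ∘ Inverse.to (layers m)

  enumerate-layer : ∀ m → Fin (sumSq m) ⊎ Fin (suc m) × Fin (suc m) → Quad
  enumerate-layer m (inj₁ x)  = shift (enumerate m x)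
  enumerate-layer m (inj₂ ij) = fresh m ij

suc+suc : ∀ a b → suc a + suc b ≡ suc (suc (a + b))
suc+suc a b = cong suc (+-suc a b)

shift-size : ∀ m p a b q → p + (a + b + q) ≡ m + m ⇔ p + (suc a + suc b + q) ≡ suc m + suc m
shift-size m p a b q = mk⇔
  (λ size → trans (shifted p a b q) (trans (cong (suc ∘ suc) size) (sym (suc+suc m m))))
  (λ size → suc-injective (suc-injective (trans (sym (shifted p a b q)) (trans size (suc+suc m m)))))
  where
    shifted : ∀ p a b q → p + (suc a + suc b + q) ≡ suc (suc (p + (a + b + q)))
    shifted = solve-∀

admissible-shift : ∀ {m Q} → Admissible m Q → Admissible (suc m) (shift Q)
admissible-shift {m} (admissible {p} {a} {b} {q} a≤m b≤m m<a+b size) =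
  admissible (s≤s a≤m) (s≤s b≤m)
    (subst (suc m <_) (sym (suc+suc a b)) (s≤s (s≤s (<⇒≤ m<a+b))))
    (Equivalence.to (shift-size m p a b q) size)

admissible-fresh : ∀ m ij → Admissible (suc m) (fresh m ij)
admissible-fresh m (i , j) =
  admissible (s≤s (subst (a ≤_) a+b≡m (m≤m+n a b))) (s≤s (subst (b ≤_) a+b≡m (m≤n+m b a)))
    (subst (suc m <_) (sym (trans (suc+suc a b) (cong (suc ∘ suc) a+b≡m))) ≤-refl)
    (Equivalence.to (shift-size m p a b q) (begin
      p + (a + b + q)   ≡⟨ x∙yz≈y∙xz p (a + b) q ⟩
      a + b + (p + q)   ≡⟨ cong₂ _+_ a+b≡m p+q≡m ⟩
      m + m             ∎))
  where
    open ≡-Reasoning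
    a = proj₁ (splits m i)
    b = proj₂ (splits m i)
    p = proj₁ (splits m j)
    q = proj₂ (splits m j)
    a+b≡m = splits-sum m i
    p+q≡m = splits-sum m j

shift-or-fresh : ∀ {m p a b q} → Admissible (suc m) (p , suc a , suc b , q) →
  Admissible m (p , a , b , q) ⊎ (a + b ≡ m × p + q ≡ m)
shift-or-fresh {m} {p} {a} {b} {q} (admissible (s≤s a≤m) (s≤s b≤m) 1+m<a+b size)
  with m≤n⇒m<n∨m≡n (s≤s⁻¹ (subst (suc m ≤_) (+-suc a b) (s≤s⁻¹ 1+m<a+b)))
... | inj₁ m<a+b = inj₁ (admissible a≤m b≤m m<a+b (Equivalence.from (shift-size m p a b q) size))
... | inj₂ m≡a+b = inj₂ (sym m≡a+b , +-cancelˡ-≡ m _ _ (begin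
  m + (p + q)     ≡⟨ cong (_+ (p + q)) m≡a+b ⟩
  a + b + (p + q) ≡⟨ x∙yz≈y∙xz p (a + b) q ⟨
  p + (a + b + q) ≡⟨ Equivalence.from (shift-size m p a b q) size ⟩
  m + m           ∎))
  where open ≡-Reasoning

enumerate-admissible : ∀ m x → Admissible m (enumerate m x)
enumerate-admissible (suc m) x with Inverse.to (layers m) x
... | inj₁ y  = admissible-shift (enumerate-admissible m y)
... | inj₂ ij = admissible-fresh m ij

shift-injective : ∀ {Q Q′} → shift Q ≡ shift Q′ → Q ≡ Q′
shift-injective {_ , _ , _ , _} {_ , _ , _ , _} refl = refl

fresh-injective : ∀ {m ij ij′} → fresh m ij ≡ fresh m ij′ → ij ≡ ij′
fresh-injective e =
  cong₂ _,_ (toℕ-injective (suc-injective (cong (proj₁ ∘ proj₂) e))) (toℕ-injective (cong proj₁ e))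

shift≢fresh : ∀ {m Q} ij → Admissible m Q → shift Q ≢ fresh m ij
shift≢fresh {m} (i , _) (admissible _ _ m<a+b _) e = <-irrefl (sym a+b≡m) m<a+b
  where
    a+b≡m = trans (cong₂ _+_ (suc-injective (cong (proj₁ ∘ proj₂) e))
                             (suc-injective (cong (proj₁ ∘ proj₂ ∘ proj₂) e)))
                  (splits-sum m i)

enumerate-injective : ∀ m {x y} → enumerate m x ≡ enumerate m y → x ≡ y
enumerate-injective (suc m) e = Injection.injective (↔⇒↣ (layers m)) (layer-injective _ _ e)
  where
    layer-injective : ∀ u v → enumerate-layer m u ≡ enumerate-layer m v → u ≡ v
    layer-injective (inj₁ y)  (inj₁ y′)  e = cong inj₁ (enumerate-injective m (shift-injective e))
    layer-injective (inj₂ ij) (inj₂ ij′) e = cong inj₂ (fresh-injective e)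
    layer-injective (inj₁ y)  (inj₂ ij)  e = ⊥-elim (shift≢fresh ij (enumerate-admissible m y) e)
    layer-injective (inj₂ ij) (inj₁ y)   e = ⊥-elim (shift≢fresh ij (enumerate-admissible m y) (sym e))

enumerate-from : ∀ m u → enumerate (suc m) (Inverse.from (layers m) u) ≡ enumerate-layer m u
enumerate-from m u = cong (enumerate-layer m) (Inverse.strictlyInverseˡ (layers m) u)

enumerate-surjective : ∀ m {Q} → Admissible m Q → ∃ λ x → enumerate m x ≡ Q
enumerate-surjective zero (admissible a≤0 b≤0 0<a+b _) = ⊥-elim (<⇒≱ 0<a+b (+-mono-≤ a≤0 b≤0))
enumerate-surjective (suc m) adm with admissible-positive adm
enumerate-surjective (suc m) adm@(admissible {a = suc _} {suc _} _ _ _ _) | _ with shift-or-fresh adm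
... | inj₁ adm′ with enumerate-surjective m adm′
...   | y , e = Inverse.from (layers m) (inj₁ y) , trans (enumerate-from m (inj₁ y)) (cong shift e)
enumerate-surjective (suc m) adm@(admissible {a = suc _} {suc _} _ _ _ _) | _
    | inj₂ (a+b≡m , p+q≡m) with splits-surjective a+b≡m | splits-surjective p+q≡m
... | i , eᵢ | j , eⱼ = Inverse.from (layers m) (inj₂ (i , j)) ,
  trans (enumerate-from m (inj₂ (i , j)))
    (cong₂ (λ (ab pq : ℕ × ℕ) → proj₁ pq , suc (proj₁ ab) , suc (proj₂ ab) , proj₂ pq) eᵢ eⱼ)

sumSq-closed-form : ∀ m → 6 * sumSq m ≡ m * (m + 1) * (2 * m + 1)
sumSq-closed-form zero    = refl
sumSq-closed-form (suc m) = begin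
  6 * (sumSq m + suc m * suc m)                   ≡⟨ *-distribˡ-+ 6 (sumSq m) _ ⟩
  6 * sumSq m + 6 * (suc m * suc m)               ≡⟨ cong (_+ 6 * (suc m * suc m)) (sumSq-closed-form m) ⟩
  m * (m + 1) * (2 * m + 1) + 6 * (suc m * suc m) ≡⟨ step m ⟩
  suc m * (suc m + 1) * (2 * suc m + 1)           ∎
  where
    open ≡-Reasoning
    step : ∀ m → m * (m + 1) * (2 * m + 1) + 6 * (suc m * suc m) ≡ suc m * (suc m + 1) * (2 * suc m + 1)
    step = solve-∀

theorem7p24 : (m : ℕ) → 1 ≤ m →
    NumClasses 2 m (sumSq m) × 6 * sumSq m ≡ m * (m + 1) * (2 * m + 1)
theorem7p24 m _ = (canon ∘ enumerate m , amplitree , separated , complete) , sumSq-closed-form m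
  where
    amplitree : ∀ i → Amplitree 2 m (canon (enumerate m i))
    amplitree i = canon-amplitree (enumerate-admissible m i)

    separated : ∀ i j → i ≢ j → ¬ MoveEq (canon (enumerate m i)) (canon (enumerate m j))
    separated i j i≢j =
      i≢j ∘ enumerate-injective m ∘ canon-separated (enumerate-admissible m i) (enumerate-admissible m j)

    complete : ∀ t → Amplitree 2 m t → ∃ λ i → MoveEq t (canon (enumerate m i))
    complete t A with amplitree-normal-form A
    ... | Q , adm , t~Q with enumerate-surjective m adm
    ...   | i , refl = i , t~Q
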